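{- White has a winning strategy in Multimove Chess $(2,1)$.
   Context: For positive integers $i,j$, Multimove Chess $(i,j)$ is the game played with exactly the rules of standard chess (standard starting position, standard piece moves, White plays first), except that on each of its turns White makes $i$ consecutive moves and on each of its turns Black makes $j$ consecutive moves. A side wins when it captures the opponent's king. A side "has a winning strategy" if it has a strategy guaranteed to win regardless of the opponent's play. -}

module Defs where

-- Multimove Chess (i , j): standard chess, White makes i consecutive moves
-- per turn, Black makes j; a side wins by capturing the opponent's king.
-- There is no check/checkmate concept: moves are the standard piece moves
-- ("pseudo-legal" moves), and the game is won by capturing the king.

open import Data.Bool using (Bool; true; false; if_then_else_; _∧_; _∨_; not)
open import Data.Nat using (ℕ; zero; suc; _<?_)
open import Data.Integer using (ℤ; +_; -[1+_]; _+_)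
open import Data.Fin using (Fin; toℕ; fromℕ<)
import Data.Fin as F
open import Data.Maybe using (Maybe; just; nothing)
open import Data.Product using (_×_; _,_; proj₁; proj₂)
open import Data.List using (List; []; _∷_; _++_; map; concatMap; allFin; cartesianProduct)
open import Data.List.Membership.Propositional using (_∈_)
open import Relation.Nullary using (¬_; yes; no)
open import Relation.Nullary.Decidable using (⌊_⌋; True)
open import Relation.Binary.PropositionalEquality using (_≡_)

data Colour : Set where
  white black : Colour

opp : Colour → Colour
opp white = black
opp black = white

_==c_ : Colour → Colour → Bool
white ==c white = true
black ==c black = true
_ ==c _ = false

data Kind : Set where
  pawn knight bishop rook queen king : Kind

isPawn isKing : Kind → Bool
isPawn pawn = true
isPawn _ = false
isKing king = true
isKing _ = false

Piece : Set
Piece = Colour × Kind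

-- (file , rank); file 0 = a-file, rank 0 = White's first rank.
Square : Set
Square = Fin 8 × Fin 8

infix 4 _==f_ _==s_ _==c_

_==f_ : Fin 8 → Fin 8 → Bool
a ==f b = ⌊ a F.≟ b ⌋

_==s_ : Square → Square → Bool
(f , r) ==s (f' , r') = (f ==f f') ∧ (r ==f r')

Board : Set
Board = Square → Maybe Piece

emptyAt : Board → Square → Bool
emptyAt b s with b s
... | nothing = true
... | just _  = false

ownAt : Board → Colour → Square → Bool
ownAt b c s with b s
... | nothing = false
... | just (c' , _) = c' ==c c

pieceAt : Board → Colour → Kind → Square → Bool
pieceAt b c k s with b s
... | nothing = false
... | just (c' , k') = (c' ==c c) ∧ kindEq k k'
  where
  kindEq : Kind → Kind → Bool
  kindEq pawn pawn = true
  kindEq knight knight = true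
  kindEq bishop bishop = true
  kindEq rook rook = true
  kindEq queen queen = true
  kindEq king king = true
  kindEq _ _ = false

shiftF : Fin 8 → ℤ → Maybe (Fin 8)
shiftF x d with (+ toℕ x) + d
... | -[1+ _ ] = nothing
... | + n with n <? 8
...   | yes n<8 = just (fromℕ< n<8)
...   | no _    = nothing

shiftSq : Square → ℤ × ℤ → Maybe Square
shiftSq (f , r) (df , dr) with shiftF f df | shiftF r dr
... | just f' | just r' = just (f' , r')
... | _ | _ = nothing

m1 : ℤ
m1 = -[1+ 0 ]
m2 : ℤ
m2 = -[1+ 1 ]

knightOffsets kingOffsets rookDirs bishopDirs queenDirs : List (ℤ × ℤ)
knightOffsets = (+ 1 , + 2) ∷ (+ 2 , + 1) ∷ (+ 2 , m1) ∷ (+ 1 , m2)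
              ∷ (m1 , m2) ∷ (m2 , m1) ∷ (m2 , + 1) ∷ (m1 , + 2) ∷ []
rookDirs = (+ 1 , + 0) ∷ (m1 , + 0) ∷ (+ 0 , + 1) ∷ (+ 0 , m1) ∷ []
bishopDirs = (+ 1 , + 1) ∷ (+ 1 , m1) ∷ (m1 , + 1) ∷ (m1 , m1) ∷ []
queenDirs = rookDirs ++ bishopDirs
kingOffsets = queenDirs

record Pos : Set where
  constructor mkPos
  field
    board    : Board
    -- castling rights (king and relevant rook have not moved)
    castleWK castleWQ castleBK castleBQ : Bool
    -- en passant target square created by the immediately preceding move
    -- (a two-square pawn advance), if any
    epSquare : Maybe Square
    toMove   : Colour
    -- number of moves the side to move still has to make in this turn
    movesLeft : ℕ
open Pos public

record Move : Set where
  constructor mkMove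
  field
    from to : Square
    promo   : Maybe Kind
open Move public

stepTargets : Board → Colour → Square → List (ℤ × ℤ) → List Square
stepTargets b c s [] = []
stepTargets b c s (d ∷ ds) with shiftSq s d
... | nothing = stepTargets b c s ds
... | just t  = if ownAt b c t then stepTargets b c s ds
                              else t ∷ stepTargets b c s ds

ray : Board → Colour → Square → ℤ × ℤ → ℕ → List Square
ray b c s d zero = []
ray b c s d (suc n) with shiftSq s d
... | nothing = []
... | just t with b t
...   | nothing = t ∷ ray b c t d n
...   | just (c' , _) = if c' ==c c then [] else t ∷ []

slideTargets : Board → Colour → Square → List (ℤ × ℤ) → List Square
slideTargets b c s ds = concatMap (λ d → ray b c s d 7) ds

plain : Square → List Square → List Move
plain s ts = map (λ t → mkMove s t nothing) ts

pawnDir : Colour → ℤ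
pawnDir white = + 1
pawnDir black = m1

startRank lastRank : Colour → Fin 8
startRank white = F.# 1
startRank black = F.# 6
lastRank white = F.# 7
lastRank black = F.# 0

pawnTo : Colour → Square → Square → List Move
pawnTo c s t =
  if proj₂ t ==f lastRank c
  then map (λ k → mkMove s t (just k)) (queen ∷ rook ∷ bishop ∷ knight ∷ [])
  else mkMove s t nothing ∷ []

pawnMoves : Pos → Colour → Square → List Move
pawnMoves p c s = forward ++ captures
  where
  b = board p
  dir = pawnDir c
  double : Square → List Move
  double t1 with proj₂ s ==f startRank c | shiftSq t1 (+ 0 , dir)
  ... | true | just t2 = if emptyAt b t2 then mkMove s t2 nothing ∷ [] else []
  ... | _ | _ = []
  forward : List Move
  forward with shiftSq s (+ 0 , dir)
  ... | nothing = []
  ... | just t1 = if emptyAt b t1 then pawnTo c s t1 ++ double t1 else []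
  epOK : Square → Bool
  epOK t with epSquare p
  ... | nothing = false
  ... | just e = (e ==s t) ∧ pieceAt b (opp c) pawn (proj₁ t , proj₂ s)
  capt : ℤ → List Move
  capt df with shiftSq s (df , dir)
  ... | nothing = []
  ... | just t = if ownAt b (opp c) t ∨ epOK t then pawnTo c s t else []
  captures : List Move
  captures = capt (+ 1) ++ capt m1

backRank : Colour → Fin 8
backRank white = F.# 0
backRank black = F.# 7

castleRights : Pos → Colour → Bool × Bool   -- (king side , queen side)
castleRights p white = castleWK p , castleWQ p
castleRights p black = castleBK p , castleBQ p

-- castling: king and rook unmoved (rights), squares between them empty.
-- Encoded as the king moving two files.
castleMoves : Pos → Colour → Square → List Move
castleMoves p c s = ks ++ qs
  where
  b = board p
  r = backRank c
  home = (F.# 4 , r)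
  ks = if (s ==s home) ∧ proj₁ (castleRights p c)
          ∧ emptyAt b (F.# 5 , r) ∧ emptyAt b (F.# 6 , r)
          ∧ pieceAt b c rook (F.# 7 , r)
       then mkMove s (F.# 6 , r) nothing ∷ [] else []
  qs = if (s ==s home) ∧ proj₂ (castleRights p c)
          ∧ emptyAt b (F.# 1 , r) ∧ emptyAt b (F.# 2 , r) ∧ emptyAt b (F.# 3 , r)
          ∧ pieceAt b c rook (F.# 0 , r)
       then mkMove s (F.# 2 , r) nothing ∷ [] else []

pieceMoves : Pos → Colour → Square → Kind → List Move
pieceMoves p c s pawn   = pawnMoves p c s
pieceMoves p c s knight = plain s (stepTargets (board p) c s knightOffsets)
pieceMoves p c s bishop = plain s (slideTargets (board p) c s bishopDirs)
pieceMoves p c s rook   = plain s (slideTargets (board p) c s rookDirs)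
pieceMoves p c s queen  = plain s (slideTargets (board p) c s queenDirs)
pieceMoves p c s king   = plain s (stepTargets (board p) c s kingOffsets)
                          ++ castleMoves p c s

allSquares : List Square
allSquares = cartesianProduct (allFin 8) (allFin 8)

movesFrom : Pos → Square → List Move
movesFrom p s with board p s
... | nothing = []
... | just (c , k) = if c ==c toMove p then pieceMoves p c s k else []

moves : Pos → List Move
moves p = concatMap (movesFrom p) allSquares

capturesKing : Pos → Move → Bool
capturesKing p m = pieceAt (board p) (opp (toMove p)) king (to m)

set : Board → Square → Maybe Piece → Board
set b s x t = if t ==s s then x else b t

applyMove : ℕ → ℕ → Pos → Move → Pos
applyMove i j p m = mkPos b'
  (castleWK p ∧ untouched (F.# 4 , F.# 0) ∧ untouched (F.# 7 , F.# 0))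
  (castleWQ p ∧ untouched (F.# 4 , F.# 0) ∧ untouched (F.# 0 , F.# 0))
  (castleBK p ∧ untouched (F.# 4 , F.# 7) ∧ untouched (F.# 7 , F.# 7))
  (castleBQ p ∧ untouched (F.# 4 , F.# 7) ∧ untouched (F.# 0 , F.# 7))
  newEp side left
  where
  b = board p
  c = toMove p
  s = from m
  t = to m
  mover : Maybe Piece
  mover with promo m
  ... | just k  = just (c , k)
  ... | nothing = b s
  isP = pieceAt b c pawn s
  isK = pieceAt b c king s
  -- en passant capture: pawn moves diagonally onto an empty square
  isEp = isP ∧ not (proj₁ s ==f proj₁ t) ∧ emptyAt b t
  kingSide  = isK ∧ (proj₁ s ==f F.# 4) ∧ (proj₁ t ==f F.# 6)
  queenSide = isK ∧ (proj₁ s ==f F.# 4) ∧ (proj₁ t ==f F.# 2)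
  r = proj₂ s
  b1 = set (set b s nothing) t mover
  b2 = if isEp then set b1 (proj₁ t , proj₂ s) nothing else b1
  b3 = if kingSide
       then set (set b2 (F.# 7 , r) nothing) (F.# 5 , r) (just (c , rook)) else b2
  b' = if queenSide
       then set (set b3 (F.# 0 , r) nothing) (F.# 3 , r) (just (c , rook)) else b3
  untouched : Square → Bool
  untouched x = not (x ==s s) ∧ not (x ==s t)
  newEp : Maybe Square
  newEp with isP | shiftSq s (+ 0 , pawnDir c)
  ... | true | just mid with shiftSq mid (+ 0 , pawnDir c)
  ...   | just t2 = if t2 ==s t then just mid else nothing
  ...   | nothing = nothing
  newEp | _ | _ = nothing
  quota : Colour → ℕ
  quota white = i
  quota black = j
  side : Colour
  side with movesLeft p
  ... | suc (suc _) = c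
  ... | _ = opp c
  left : ℕ
  left with movesLeft p
  ... | suc (suc n) = suc n
  ... | _ = quota (opp c)

backRankPiece : Fin 8 → Kind
backRankPiece F.zero = rook
backRankPiece (F.suc F.zero) = knight
backRankPiece (F.suc (F.suc F.zero)) = bishop
backRankPiece (F.suc (F.suc (F.suc F.zero))) = queen
backRankPiece (F.suc (F.suc (F.suc (F.suc F.zero)))) = king
backRankPiece (F.suc (F.suc (F.suc (F.suc (F.suc F.zero))))) = bishop
backRankPiece (F.suc (F.suc (F.suc (F.suc (F.suc (F.suc F.zero)))))) = knight
backRankPiece (F.suc (F.suc (F.suc (F.suc (F.suc (F.suc (F.suc F.zero))))))) = rook

initialBoard : Board
initialBoard (f , F.zero) = just (white , backRankPiece f)
initialBoard (f , F.suc F.zero) = just (white , pawn)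
initialBoard (f , F.suc (F.suc (F.suc (F.suc (F.suc (F.suc F.zero)))))) = just (black , pawn)
initialBoard (f , F.suc (F.suc (F.suc (F.suc (F.suc (F.suc (F.suc F.zero))))))) = just (black , backRankPiece f)
initialBoard _ = nothing

initialPos : ℕ → Pos
initialPos i = mkPos initialBoard true true true true nothing white i

-- Inductively: White to move has a move capturing the king,
-- or a (non-king-capturing) move to a winning position; Black to move has
-- at least one move (no move = game cannot go on, not a White win) and
-- every Black move fails to capture White's king and leads to a winning
-- position.

data WhiteWins (i j : ℕ) : Pos → Set where
  captureKing : ∀ {p} m → toMove p ≡ white → m ∈ moves p →
                capturesKing p m ≡ true → WhiteWins i j p
  whiteMove : ∀ {p} m → toMove p ≡ white → m ∈ moves p →
              capturesKing p m ≡ false →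
              WhiteWins i j (applyMove i j p m) → WhiteWins i j p
  blackMove : ∀ {p} → toMove p ≡ black → (m₀ : Move) → m₀ ∈ moves p →
              (∀ m → m ∈ moves p →
                 capturesKing p m ≡ false × WhiteWins i j (applyMove i j p m)) →
              WhiteWins i j p

WhiteHasWinningStrategy : ℕ → ℕ → Set
WhiteHasWinningStrategy i j = WhiteWins i j (initialPos i)

-- White's first turn is Nb1–c3–d5. A single Black move can neither capture
-- the knight on d5 nor take the king off e8, so White's second turn
-- Nd5–f6, Nf6×e8 captures the king.

module Submission where

open import Defs
open import Data.Bool using (Bool; true; false; _∧_; not; T)
open import Data.Bool.Properties using (T-∧; T-≡; T-not-≡)
open import Data.Empty using (⊥-elim)
open import Data.Fin using (#_)
open import Data.List using (List; []; _∷_; null; findᵇ)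
open import Data.List.Membership.Propositional using (_∈_)
open import Data.List.Relation.Unary.Any using (here; there)
open import Data.Maybe using (Maybe; just; nothing)
open import Data.Nat using (ℕ)
open import Data.Product using (Σ; _×_; _,_)
open import Data.Unit using (tt)
open import Function.Bundles using (Equivalence)
open import Relation.Binary.PropositionalEquality using (_≡_; refl)

findᵇ-∈ : {A : Set} (p : A → Bool) (xs : List A) {x : A} → findᵇ p xs ≡ just x → x ∈ xs
findᵇ-∈ p (y ∷ ys) found with p y
findᵇ-∈ p (y ∷ ys) refl  | true  = here refl
findᵇ-∈ p (y ∷ ys) found | false = there (findᵇ-∈ p ys found)

¬null⇒∈ : {A : Set} (xs : List A) → T (not (null xs)) → Σ A (_∈ xs)
¬null⇒∈ (x ∷ _) _ = x , here refl

==c-sound : ∀ c c′ → T (c ==c c′) → c ≡ c′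
==c-sound white white _ = refl
==c-sound black black _ = refl

∧-split : ∀ {x y} → T (x ∧ y) → T x × T y
∧-split = Equivalence.to T-∧

-- A move given by its squares; the first match in the move list is taken,
-- so for a promotion this is the queen.
moveBetween : Pos → Square → Square → Maybe Move
moveBetween p s t = findᵇ (λ m → (from m ==s s) ∧ (to m ==s t)) (moves p)

moveBetween-∈ : ∀ p s t {m} → moveBetween p s t ≡ just m → m ∈ moves p
moveBetween-∈ p s t = findᵇ-∈ _ (moves p)

data Strategy : Set where
  captureOn : Square → Square → Strategy
  playThen  : Square → Square → Strategy → Strategy
  answer    : (Move → Strategy) → Strategy

module _ (i j : ℕ) where

  WinsAfter : Pos → Move → Set
  WinsAfter p m = capturesKing p m ≡ false × WhiteWins i j (applyMove i j p m)

  capturesWith : Pos → Maybe Move → Bool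
  capturesWith p nothing  = false
  capturesWith p (just m) = capturesKing p m

  mutual
    check : Strategy → Pos → Bool
    check (captureOn s t) p  = (toMove p ==c white) ∧ capturesWith p (moveBetween p s t)
    check (playThen s t σ) p = (toMove p ==c white) ∧ continuesWith σ p (moveBetween p s t)
    check (answer σ) p       =
      (toMove p ==c black) ∧ (not (null (moves p)) ∧ allAnswered σ p (moves p))

    continuesWith : Strategy → Pos → Maybe Move → Bool
    continuesWith σ p nothing  = false
    continuesWith σ p (just m) = not (capturesKing p m) ∧ check σ (applyMove i j p m)

    allAnswered : (Move → Strategy) → Pos → List Move → Bool
    allAnswered σ p []       = true
    allAnswered σ p (m ∷ ms) = continuesWith (σ m) p (just m) ∧ allAnswered σ p ms

  mutual
    check-sound : ∀ σ p → T (check σ p) → WhiteWins i j p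
    check-sound (captureOn s t) p ok with ∧-split {toMove p ==c white} ok
    ... | isWhite , captures with moveBetween p s t in found
    ...   | nothing = ⊥-elim captures
    ...   | just m  = captureKing m (==c-sound _ _ isWhite) (moveBetween-∈ p s t found)
                                    (Equivalence.to T-≡ captures)
    check-sound (playThen s t σ) p ok with ∧-split {toMove p ==c white} ok
    ... | isWhite , continues with moveBetween p s t in found
    ...   | nothing = ⊥-elim continues
    ...   | just m  with continuesWith-sound σ p m continues
    ...     | quiet , wins =
      whiteMove m (==c-sound _ _ isWhite) (moveBetween-∈ p s t found) quiet wins
    check-sound (answer σ) p ok with ∧-split {toMove p ==c black} ok
    ... | isBlack , rest with ∧-split {not (null (moves p))} rest
    ...   | nonEmpty , answered with ¬null⇒∈ (moves p) nonEmpty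
    ...     | m₀ , m₀∈ = blackMove (==c-sound _ _ isBlack) m₀ m₀∈
                                     (allAnswered-sound σ p (moves p) answered)

    continuesWith-sound : ∀ σ p m → T (continuesWith σ p (just m)) → WinsAfter p m
    continuesWith-sound σ p m ok with ∧-split {not (capturesKing p m)} ok
    ... | quiet , continues =
      Equivalence.to T-not-≡ quiet , check-sound σ (applyMove i j p m) continues

    allAnswered-sound : ∀ σ p ms → T (allAnswered σ p ms) → ∀ m → m ∈ ms → WinsAfter p m
    allAnswered-sound σ p (m ∷ ms) ok m′ m′∈ with ∧-split {continuesWith (σ m) p (just m)} ok | m′∈
    ... | first , _    | here refl  = continuesWith-sound (σ m) p m first
    ... | _     , rest | there m′∈′ = allAnswered-sound σ p ms rest m′ m′∈′

b1 c3 d5 f6 e8 : Square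
b1 = # 1 , # 0
c3 = # 2 , # 2
d5 = # 3 , # 4
f6 = # 5 , # 5
e8 = # 4 , # 7

knightRaid : Strategy
knightRaid = playThen b1 c3 (playThen c3 d5 (answer λ _ → playThen d5 f6 (captureOn f6 e8)))

lemma2 : WhiteHasWinningStrategy 2 1
lemma2 = check-sound 2 1 knightRaid (initialPos 2) tt
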